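{- Let $j$ be a nonnegative integer, and let $m=2^Lh+1$ be a positive integer where $L,h$ are integers with $L\ge3$ and $h$ odd. Let $\ell=\lceil\log_2(m+j)\rceil$. Then $$\mathfrak{K}_j(m)<2^\ell+\frac{2^\ell(2^{L+1}+4)-j}{m}.$$
   Context: The Thue–Morse word $\mathbf{t}=\mathbf{t}_1\mathbf{t}_2\mathbf{t}_3\cdots=0110100110010110\cdots$ is the infinite binary word whose $i$-th letter $\mathbf{t}_i$ ($i\ge 1$) is the parity of the number of 1's in the binary expansion of $i-1$. A $k$-anti-power is a word $w^{(1)}\cdots w^{(k)}$ with $w^{(1)},\dots,w^{(k)}$ pairwise distinct words of the same length. For $j\ge0$, the $j$-fix of $\mathbf{t}$ of length $N$ is $\mathbf{t}_{j+1}\cdots\mathbf{t}_{j+N}$. For a positive integer $m$, $\mathfrak{K}_j(m)$ is the smallest positive integer $k$ such that the $j$-fix of $\mathbf{t}$ of length $km$ is not a $k$-anti-power. -}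

module Defs where

open import Data.Nat using (ℕ; zero; suc; _+_; _*_; _<_; _≤_; _/_; _%_)
open import Data.Bool using (Bool; true; false; _xor_)
open import Data.List using (List; map; upTo)
open import Data.Product using (_×_)
open import Relation.Binary.PropositionalEquality using (_≡_; _≢_)
open import Relation.Nullary using (¬_)

-- Number of 1's in the binary expansion of n, computed with fuel f
-- (fuel n suffices, since n halves at each step).
popcountFuel : ℕ → ℕ → ℕ
popcountFuel zero    n = 0
popcountFuel (suc f) n = n % 2 + popcountFuel f (n / 2)

popcount : ℕ → ℕ
popcount n = popcountFuel n n

-- Parity as a letter in {0,1} = {false,true}.
parityBit : ℕ → Bool
parityBit zero          = false
parityBit (suc zero)    = true
parityBit (suc (suc n)) = parityBit n

-- Thue–Morse word, 1-indexed: t i = parity of the number of 1's of (i-1), for i ≥ 1.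
-- We use the 0-indexed version tm n = t (n+1) = parity of popcount n.
tm : ℕ → Bool
tm n = parityBit (popcount n)

-- The r-th block (r ≥ 0) of length m of the j-fix of t, i.e. w^(r+1) in the paper:
-- t_{j+rm+1} ⋯ t_{j+rm+m}  =  tm (j+rm) ⋯ tm (j+rm+m-1).
block : ℕ → ℕ → ℕ → List Bool
block j m r = map (λ i → tm (j + r * m + i)) (upTo m)

IsAntiPower : ℕ → ℕ → ℕ → Set
IsAntiPower j m k = ∀ r s → r < k → s < k → r ≢ s → block j m r ≢ block j m s

-- k = 𝔎_j(m): k is the smallest positive integer such that the j-fix of length km
-- is not a k-anti-power.
IsK : ℕ → ℕ → ℕ → Set
IsK j m k = (1 ≤ k) × ¬ IsAntiPower j m k × (∀ k' → 1 ≤ k' → k' < k → IsAntiPower j m k')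

module Submission where

-- Write P = 2^ℓ ≥ m + j.  The Thue–Morse word satisfies
-- tm (c + 2^n x) = tm c xor tm x for c < 2^n (`tm-split`).  Hence if the
-- two letters at positions a and a + 1 agree with the letters m further on,
-- then the whole window [P a, P a + 2P) agrees with the word P m further on
-- (`window-matches`).  Choosing r with P a ≤ j + r m < P a + m, the r-th
-- block of the j-fix lies in that window, so it equals block r + P
-- (`blocks-repeat`); the first repetition of a block then gives 𝔎_j(m)
-- together with the bound 𝔎_j(m) ≤ r + P + 1 (`K-from-repetition`,
-- `bounded-K`).  Finally, for m = 2^L h + 1 a suitable position is
-- a = 2 + 2^L q with q ≤ 2 chosen so that tm (h + q) ≠ tm q, which exists
-- because h is odd (`flip-offset`, `thue-morse-matches`); then
-- a + 2 ≤ 2^(L+1) + 4 gives the theorem.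

open import Defs
open import Data.Nat
open import Data.Nat.Properties
open import Data.Nat.DivMod
open import Data.Nat.Divisibility using (divides-refl)
open import Data.Nat.Induction using (<-rec)
open import Data.Nat.Logarithm using (⌈log₂_⌉)
open import Data.Nat.Logarithm.Core using (⌈log2⌉)
open import Data.Nat.Tactic.RingSolver using (solve-∀)
open import Induction.WellFounded using (Acc; acc)
open import Data.Bool using (T; true; false; not; _xor_)
open import Data.Bool.Properties using (xor-assoc; not-involutive) renaming (_≟_ to _≟ᵇ_)
open import Data.List.Properties using (≡-dec; map-cong-local)
open import Data.List.Relation.Unary.All using () renaming (map to All-map)
open import Data.List.Relation.Unary.All.Properties using (all-upTo)
open import Data.Product using (Σ; ∃; _×_; _,_)
open import Relation.Binary using (tri<; tri≈; tri>)
open import Relation.Binary.PropositionalEquality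
open import Relation.Nullary using (Dec; yes; no; ¬_)

-- Binary digits and the Thue–Morse word

popcountFuel-zero : ∀ f → popcountFuel f 0 ≡ 0
popcountFuel-zero zero    = refl
popcountFuel-zero (suc f) = popcountFuel-zero f

half-≤ : ∀ n f → n ≤ suc f → n / 2 ≤ f
half-≤ zero    f _ = z≤n
half-≤ (suc n) f n≤ = ≤-pred (≤-trans (m/n<m (suc n) 2 (s≤s (s≤s z≤n))) n≤)

popcountFuel-irrelevant : ∀ f g n → n ≤ f → n ≤ g → popcountFuel f n ≡ popcountFuel g n
popcountFuel-irrelevant zero    g       .zero z≤n _   = sym (popcountFuel-zero g)
popcountFuel-irrelevant (suc f) zero    .zero _   z≤n = popcountFuel-zero (suc f)
popcountFuel-irrelevant (suc f) (suc g) n     n≤f n≤g =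
  cong (n % 2 +_) (popcountFuel-irrelevant f g (n / 2) (half-≤ n f n≤f) (half-≤ n g n≤g))

popcount-step : ∀ n → popcount n ≡ n % 2 + popcount (n / 2)
popcount-step zero    = refl
popcount-step (suc f) =
  cong (suc f % 2 +_) (popcountFuel-irrelevant f (suc f / 2) (suc f / 2) (half-≤ (suc f) f ≤-refl) ≤-refl)

parity-suc : ∀ n → parityBit (suc n) ≡ not (parityBit n)
parity-suc zero          = refl
parity-suc (suc zero)    = refl
parity-suc (suc (suc n)) = parity-suc n

parity-+ : ∀ a b → parityBit (a + b) ≡ parityBit a xor parityBit b
parity-+ zero          b = refl
parity-+ (suc zero)    b = parity-suc b
parity-+ (suc (suc a)) b = parity-+ a b

tm-digit : ∀ b y → b < 2 → tm (b + y * 2) ≡ parityBit b xor tm y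
tm-digit b y b<2 = begin
    tm (b + y * 2)
  ≡⟨ cong parityBit (popcount-step (b + y * 2)) ⟩
    parityBit ((b + y * 2) % 2 + popcount ((b + y * 2) / 2))
  ≡⟨ cong₂ (λ u v → parityBit (u + popcount v)) low-digit high-digits ⟩
    parityBit (b + popcount y)
  ≡⟨ parity-+ b (popcount y) ⟩
    parityBit b xor tm y
  ∎
  where
  open ≡-Reasoning
  low-digit : (b + y * 2) % 2 ≡ b
  low-digit = trans ([m+kn]%n≡m%n b y 2) (m<n⇒m%n≡m b<2)
  high-digits : (b + y * 2) / 2 ≡ y
  high-digits = begin
      (b + y * 2) / 2  ≡⟨ +-distrib-/-∣ʳ b (divides-refl y) ⟩
      b / 2 + y * 2 / 2 ≡⟨ cong₂ _+_ (m<n⇒m/n≡0 b<2) (m*n/n≡m y 2) ⟩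
      y                 ∎

tm-split : ∀ n x c → c < 2 ^ n → tm (c + 2 ^ n * x) ≡ tm c xor tm x
tm-split zero    x zero    _        = cong tm (+-identityʳ x)
tm-split zero    x (suc c) (s≤s ())
tm-split (suc n) x c       c<2^1+n  = begin
    tm (c + 2 ^ suc n * x)
  ≡⟨ cong (λ u → tm (u + 2 ^ suc n * x)) c-digits ⟩
    tm (c₀ + c' * 2 + 2 * 2 ^ n * x)
  ≡⟨ cong tm (regroup c₀ c' (2 ^ n) x) ⟩
    tm (c₀ + (c' + 2 ^ n * x) * 2)
  ≡⟨ tm-digit c₀ (c' + 2 ^ n * x) c₀<2 ⟩
    parityBit c₀ xor tm (c' + 2 ^ n * x)
  ≡⟨ cong (parityBit c₀ xor_) (tm-split n x c' c'<2^n) ⟩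
    parityBit c₀ xor (tm c' xor tm x)
  ≡⟨ xor-assoc (parityBit c₀) (tm c') (tm x) ⟨
    (parityBit c₀ xor tm c') xor tm x
  ≡⟨ cong (_xor tm x) (tm-digit c₀ c' c₀<2) ⟨
    tm (c₀ + c' * 2) xor tm x
  ≡⟨ cong (λ u → tm u xor tm x) c-digits ⟨
    tm c xor tm x
  ∎
  where
  open ≡-Reasoning
  c₀ = c % 2
  c' = c / 2
  c₀<2 : c₀ < 2
  c₀<2 = m%n<n c 2
  c-digits : c ≡ c₀ + c' * 2
  c-digits = m≡m%n+[m/n]*n c 2
  c'<2^n : c' < 2 ^ n
  c'<2^n = m<n*o⇒m/o<n (subst (c <_) (*-comm 2 (2 ^ n)) c<2^1+n)
  regroup : ∀ b y Q x → b + y * 2 + 2 * Q * x ≡ b + (y + Q * x) * 2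
  regroup = solve-∀

-- Ceiling logarithm

≤-2^⌈log2⌉ : ∀ n (rec : Acc _<_ n) → n ≤ 2 ^ ⌈log2⌉ n rec
≤-2^⌈log2⌉ zero          _        = z≤n
≤-2^⌈log2⌉ (suc zero)    _        = s≤s z≤n
≤-2^⌈log2⌉ (suc (suc n)) (acc rs) = begin
    suc (suc n)                ≤⟨ s≤s (s≤s n≤2⌈n/2⌉) ⟩
    suc (suc (h + h))          ≡⟨ cong suc (+-suc h h) ⟨
    suc h + suc h              ≤⟨ +-mono-≤ ih ih ⟩
    2 ^ k + 2 ^ k              ≡⟨ cong (2 ^ k +_) (+-identityʳ (2 ^ k)) ⟨
    2 ^ suc k                  ∎
  where
  open ≤-Reasoning
  h = ⌈ n /2⌉
  k = ⌈log2⌉ (suc h) (rs (⌈n/2⌉<n n))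
  ih : suc h ≤ 2 ^ k
  ih = ≤-2^⌈log2⌉ (suc h) (rs (⌈n/2⌉<n n))
  n≤2⌈n/2⌉ : n ≤ h + h
  n≤2⌈n/2⌉ = subst (_≤ h + h) (⌊n/2⌋+⌈n/2⌉≡n n) (+-monoˡ-≤ h (⌊n/2⌋≤⌈n/2⌉ n))

≤-2^⌈log₂⌉ : ∀ n → n ≤ 2 ^ ⌈log₂ n ⌉
≤-2^⌈log₂⌉ n = ≤-2^⌈log2⌉ n _

-- Propagating letter matches

MatchesAt : ℕ → ℕ → Set
MatchesAt d x = tm (x + d) ≡ tm x

match-lift : ∀ ℓ m a c → c < 2 ^ ℓ → MatchesAt m a → MatchesAt (2 ^ ℓ * m) (c + 2 ^ ℓ * a)
match-lift ℓ m a c c<P match = begin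
    tm (c + P * a + P * m)  ≡⟨ cong tm (regroup c P a m) ⟩
    tm (c + P * (a + m))    ≡⟨ tm-split ℓ (a + m) c c<P ⟩
    tm c xor tm (a + m)     ≡⟨ cong (tm c xor_) match ⟩
    tm c xor tm a           ≡⟨ tm-split ℓ a c c<P ⟨
    tm (c + P * a)          ∎
  where
  open ≡-Reasoning
  P = 2 ^ ℓ
  regroup : ∀ c P a m → c + P * a + P * m ≡ c + P * (a + m)
  regroup = solve-∀

window-matches : ∀ ℓ m a x → MatchesAt m a → MatchesAt m (suc a) →
                 2 ^ ℓ * a ≤ x → x < 2 ^ ℓ * a + (2 ^ ℓ + 2 ^ ℓ) → MatchesAt (2 ^ ℓ * m) x
window-matches ℓ m a x match match' Pa≤x x<end =
  subst (MatchesAt (P * m)) (m∸n+n≡m Pa≤x) (matches-at-offset (x ∸ P * a) x-offset<2P)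
  where
  open ≡-Reasoning
  P = 2 ^ ℓ
  x-offset<2P : x ∸ P * a < P + P
  x-offset<2P = subst (x ∸ P * a <_) (m+n∸m≡n (P * a) (P + P)) (∸-monoˡ-< x<end Pa≤x)
  -- An offset c below 2P lies in the block above a or in the one above a + 1.
  matches-at-offset : ∀ c → c < P + P → MatchesAt (P * m) (c + P * a)
  matches-at-offset c c<2P with c <? P
  ... | yes c<P = match-lift ℓ m a c c<P match
  ... | no  c≮P = subst (MatchesAt (P * m)) c≡ (match-lift ℓ m (suc a) (c ∸ P) c∸P<P match')
    where
    P≤c : P ≤ c
    P≤c = ≮⇒≥ c≮P
    c∸P<P : c ∸ P < P
    c∸P<P = subst (c ∸ P <_) (m+n∸m≡n P P) (∸-monoˡ-< c<2P P≤c)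
    c≡ : c ∸ P + P * suc a ≡ c + P * a
    c≡ = begin
      c ∸ P + P * suc a    ≡⟨ cong (c ∸ P +_) (*-suc P a) ⟩
      c ∸ P + (P + P * a)  ≡⟨ +-assoc (c ∸ P) P (P * a) ⟨
      c ∸ P + P + P * a    ≡⟨ cong (_+ P * a) (m∸n+n≡m P≤c) ⟩
      c + P * a            ∎

-- If block r of the j-fix starts in [2^ℓ a, 2^ℓ a + m) and m ≤ 2^ℓ, the
-- block lies in the window of `window-matches`, so it equals block r + 2^ℓ.
blocks-repeat : ∀ ℓ m j a r → MatchesAt m a → MatchesAt m (suc a) → m ≤ 2 ^ ℓ →
                2 ^ ℓ * a ≤ j + r * m → j + r * m < 2 ^ ℓ * a + m →
                block j m r ≡ block j m (r + 2 ^ ℓ)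
blocks-repeat ℓ m j a r match match' m≤P lo hi = map-cong-local (All-map letter (all-upTo m))
  where
  open ≡-Reasoning
  P = 2 ^ ℓ
  shift : ∀ j r P m i → j + r * m + i + P * m ≡ j + (r + P) * m + i
  shift = solve-∀
  letter : ∀ {i} → i < m → tm (j + r * m + i) ≡ tm (j + (r + P) * m + i)
  letter {i} i<m = begin
      tm (j + r * m + i)          ≡⟨ window-matches ℓ m a (j + r * m + i) match match' Pa≤x x<end ⟨
      tm (j + r * m + i + P * m)  ≡⟨ cong tm (shift j r P m i) ⟩
      tm (j + (r + P) * m + i)    ∎
    where
    Pa≤x : P * a ≤ j + r * m + i
    Pa≤x = ≤-trans lo (m≤m+n (j + r * m) i)
    x<end : j + r * m + i < P * a + (P + P)
    x<end = <-≤-trans (+-mono-< hi i<m)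
              (≤-trans (≤-reflexive (+-assoc (P * a) m m)) (+-monoʳ-≤ (P * a) (+-mono-≤ m≤P m≤P)))

-- From a repeated block to 𝔎

module _ {P : ℕ → Set} (P? : ∀ n → Dec (P n)) where

  LeastWitnessBelow : ℕ → Set
  LeastWitnessBelow n = ∃ λ w → w ≤ n × P w × (∀ {v} → v < w → ¬ P v)

  least-witness : ∀ n → P n → LeastWitnessBelow n
  least-witness = <-rec (λ n → P n → LeastWitnessBelow n) step
    where
    step : ∀ n → (∀ {v} → v < n → P v → LeastWitnessBelow v) → P n → LeastWitnessBelow n
    step n smaller Pn with anyUpTo? P? n
    ... | no none = n , ≤-refl , Pn , λ v<n Pv → none (_ , v<n , Pv)
    ... | yes (v , v<n , Pv) with smaller v<n Pv
    ...   | w , w≤v , Pw , least = w , ≤-trans w≤v (<⇒≤ v<n) , Pw , least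

Repeats : ℕ → ℕ → ℕ → Set
Repeats j m s = ∃ λ r → r < s × block j m r ≡ block j m s

repeats? : ∀ j m s → Dec (Repeats j m s)
repeats? j m s = anyUpTo? (λ r → ≡-dec _≟ᵇ_ (block j m r) (block j m s)) s

first-repeat-is-K : ∀ j m s → Repeats j m s → (∀ {t} → t < s → ¬ Repeats j m t) → IsK j m (suc s)
first-repeat-is-K j m s (r , r<s , same) first = s≤s z≤n , not-anti-power , anti-power-below
  where
  not-anti-power : ¬ IsAntiPower j m (suc s)
  not-anti-power anti = anti r s (m≤n⇒m≤1+n r<s) ≤-refl (<⇒≢ r<s) same
  anti-power-below : ∀ k → 1 ≤ k → k < suc s → IsAntiPower j m k
  anti-power-below k _ k≤s r' s' r'<k s'<k r'≢s' same' with <-cmp r' s'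
  ... | tri< r'<s' _ _ = first (<-≤-trans s'<k (≤-pred k≤s)) (r' , r'<s' , same')
  ... | tri≈ _ r'≡s' _ = r'≢s' r'≡s'
  ... | tri> _ _ s'<r' = first (<-≤-trans r'<k (≤-pred k≤s)) (s' , s'<r' , sym same')

K-from-repetition : ∀ j m s → Repeats j m s → ∃ λ k → IsK j m k × k ≤ suc s
K-from-repetition j m s rep with least-witness (repeats? j m) s rep
... | s* , s*≤s , rep* , first = suc s* , first-repeat-is-K j m s* rep* first , s≤s s*≤s

-- The general bound

multiple-in-window : ∀ m → 1 ≤ m → ∀ d → ∃ λ r → d ≤ r * m × r * m < d + m
multiple-in-window m m≥1 zero = 0 , z≤n , m≥1
multiple-in-window m m≥1 (suc d) with multiple-in-window m m≥1 d
... | r , d≤rm , rm<d+m with d <? r * m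
...   | yes d<rm = r , d<rm , m≤n⇒m≤1+n rm<d+m
...   | no  d≮rm = suc r , ≤-trans (s≤s (≤-reflexive d≡rm)) (+-monoˡ-≤ (r * m) m≥1) , next<
  where
  d≡rm : d ≡ r * m
  d≡rm = ≤-antisym d≤rm (≮⇒≥ d≮rm)
  next< : m + r * m < suc d + m
  next< = s≤s (≤-reflexive (trans (+-comm m (r * m)) (cong (_+ m) (sym d≡rm))))

progression-in-window : ∀ m j d → 1 ≤ m → j ≤ d → ∃ λ r → d ≤ j + r * m × j + r * m < d + m
progression-in-window m j d m≥1 j≤d with multiple-in-window m m≥1 (d ∸ j)
... | r , lo , hi = r , subst (_≤ j + r * m) d≡ (+-monoʳ-≤ j lo) , subst (j + r * m <_) d+m≡ (+-monoʳ-< j hi)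
  where
  d≡ : j + (d ∸ j) ≡ d
  d≡ = m+[n∸m]≡n j≤d
  d+m≡ : j + (d ∸ j + m) ≡ d + m
  d+m≡ = trans (sym (+-assoc j (d ∸ j) m)) (cong (_+ m) d≡)

bounded-K : ∀ j m ℓ a → 1 ≤ m → m + j ≤ 2 ^ ℓ → 1 ≤ a → MatchesAt m a → MatchesAt m (suc a) →
            ∃ λ k → IsK j m k × k * m + j < 2 ^ ℓ * m + 2 ^ ℓ * (a + 2)
bounded-K j m ℓ a m≥1 m+j≤P a≥1 match match'
  with progression-in-window m j (2 ^ ℓ * a) m≥1 j≤Pa
  where
  j≤Pa : j ≤ 2 ^ ℓ * a
  j≤Pa = ≤-trans (m≤n+m j m) (≤-trans m+j≤P (m≤m*n (2 ^ ℓ) a {{>-nonZero a≥1}}))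
... | r , lo , hi with K-from-repetition j m (r + 2 ^ ℓ) (r , r<r+P , same)
  where
  P = 2 ^ ℓ
  m≤P : m ≤ P
  m≤P = ≤-trans (m≤m+n m j) m+j≤P
  r<r+P : r < r + P
  r<r+P = subst (_≤ r + P) (+-comm r 1) (+-monoʳ-≤ r (≤-trans m≥1 m≤P))
  same : block j m r ≡ block j m (r + P)
  same = blocks-repeat ℓ m j a r match match' m≤P lo hi
... | k , isK , k≤ = k , isK , bound
  where
  open ≤-Reasoning
  P = 2 ^ ℓ
  m≤P : m ≤ P
  m≤P = ≤-trans (m≤m+n m j) m+j≤P
  expand : ∀ j r P m → suc (r + P) * m + j ≡ j + r * m + m + P * m
  expand = solve-∀
  collect : ∀ P a m → P * a + (P + P) + P * m ≡ P * m + P * (a + 2)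
  collect = solve-∀
  bound : k * m + j < P * m + P * (a + 2)
  bound = begin-strict
    k * m + j                  ≤⟨ +-monoˡ-≤ j (*-monoˡ-≤ m k≤) ⟩
    suc (r + P) * m + j        ≡⟨ expand j r P m ⟩
    j + r * m + m + P * m      <⟨ +-monoˡ-< (P * m) (+-monoˡ-< m hi) ⟩
    P * a + m + m + P * m      ≤⟨ +-monoˡ-≤ (P * m) (≤-trans (≤-reflexive (+-assoc (P * a) m m))
                                    (+-monoʳ-≤ (P * a) (+-mono-≤ m≤P m≤P))) ⟩
    P * a + (P + P) + P * m    ≡⟨ collect P a m ⟩
    P * m + P * (a + 2)        ∎

-- The case m = 2^L h + 1

-- Indeed h + 1 = 2(y + 1) and h + 2 = 1 + 2(y + 1) give tm (h + 2) = not tm (h + 1),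
-- so q = 1 works unless tm (h + 1) = true, in which case q = 2 works.
flip-offset : ∀ h → h % 2 ≡ 1 → ∃ λ q → q ≤ 2 × tm (h + q) ≡ not (tm q)
flip-offset h h-odd with tm (h + 1) in tm-h+1
... | false = 1 , s≤s z≤n , tm-h+1
... | true  = 2 , ≤-refl , tm-h+2
  where
  open ≡-Reasoning
  y = h / 2
  h≡ : h ≡ 1 + y * 2
  h≡ = trans (m≡m%n+[m/n]*n h 2) (cong (_+ y * 2) h-odd)
  even : ∀ y → 1 + y * 2 + 1 ≡ 0 + (1 + y) * 2
  even = solve-∀
  odd : ∀ y → 1 + y * 2 + 2 ≡ 1 + (1 + y) * 2
  odd = solve-∀
  tm-h+2 : tm (h + 2) ≡ false
  tm-h+2 = begin
    tm (h + 2)                   ≡⟨ cong (λ u → tm (u + 2)) h≡ ⟩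
    tm (1 + y * 2 + 2)           ≡⟨ cong tm (odd y) ⟩
    tm (1 + (1 + y) * 2)         ≡⟨ tm-digit 1 (1 + y) (s≤s (s≤s z≤n)) ⟩
    not (tm (1 + y))             ≡⟨ cong not (tm-digit 0 (1 + y) (s≤s z≤n)) ⟨
    not (tm (0 + (1 + y) * 2))   ≡⟨ cong (λ u → not (tm u)) (even y) ⟨
    not (tm (1 + y * 2 + 1))     ≡⟨ cong (λ u → not (tm (u + 1))) h≡ ⟨
    not (tm (h + 1))             ≡⟨ cong not tm-h+1 ⟩
    false                        ∎

-- With m = 2^L h + 1 (L ≥ 3) and a flipping offset q, tm has matches at
-- distance m at the positions 2 + 2^L q and 3 + 2^L q: both sides split
-- by `tm-split` into a small part (2, 3 or 4, all below 2^L) and a high part.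
thue-morse-matches : ∀ L h q → 3 ≤ L → tm (h + q) ≡ not (tm q) →
                     MatchesAt (2 ^ L * h + 1) (2 + 2 ^ L * q) × MatchesAt (2 ^ L * h + 1) (3 + 2 ^ L * q)
thue-morse-matches L h q L≥3 flip = match₂ , match₃
  where
  open ≡-Reasoning
  Q = 2 ^ L
  small : ∀ c → T (c <ᵇ 8) → c < Q
  small c c<8 = <-≤-trans (<ᵇ⇒< c 8 c<8) (^-monoʳ-≤ 2 L≥3)
  regroup : ∀ c Q q h → c + Q * q + (Q * h + 1) ≡ suc c + Q * (h + q)
  regroup = solve-∀
  match₂ : tm (2 + Q * q + (Q * h + 1)) ≡ tm (2 + Q * q)
  match₂ = begin
    tm (2 + Q * q + (Q * h + 1))  ≡⟨ cong tm (regroup 2 Q q h) ⟩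
    tm (3 + Q * (h + q))          ≡⟨ tm-split L (h + q) 3 (small 3 _) ⟩
    tm (h + q)                    ≡⟨ flip ⟩
    not (tm q)                    ≡⟨ tm-split L q 2 (small 2 _) ⟨
    tm (2 + Q * q)                ∎
  match₃ : tm (3 + Q * q + (Q * h + 1)) ≡ tm (3 + Q * q)
  match₃ = begin
    tm (3 + Q * q + (Q * h + 1))  ≡⟨ cong tm (regroup 3 Q q h) ⟩
    tm (4 + Q * (h + q))          ≡⟨ tm-split L (h + q) 4 (small 4 _) ⟩
    not (tm (h + q))              ≡⟨ cong not flip ⟩
    not (not (tm q))              ≡⟨ not-involutive (tm q) ⟩
    tm q                          ≡⟨ tm-split L q 3 (small 3 _) ⟨
    tm (3 + Q * q)                ∎

position-bound : ∀ L q → q ≤ 2 → 2 + 2 ^ L * q + 2 ≤ 2 ^ (L + 1) + 4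
position-bound L q q≤2 = begin
    2 + 2 ^ L * q + 2  ≡⟨ rearrange (2 ^ L * q) ⟩
    2 ^ L * q + 4      ≤⟨ +-monoˡ-≤ 4 (*-monoʳ-≤ (2 ^ L) q≤2) ⟩
    2 ^ L * 2 + 4      ≡⟨ cong (_+ 4) (^-distribˡ-+-* 2 L 1) ⟨
    2 ^ (L + 1) + 4    ∎
  where
  open ≤-Reasoning
  rearrange : ∀ x → 2 + x + 2 ≡ x + 4
  rearrange = solve-∀

mainTheorem12 : (j L h : ℕ) → 3 ≤ L → h % 2 ≡ 1 →
    let m = 2 ^ L * h + 1
        ℓ = ⌈log₂ (m + j) ⌉
    in Σ ℕ (λ k → IsK j m k × (k * m + j < 2 ^ ℓ * m + 2 ^ ℓ * (2 ^ (L + 1) + 4)))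
mainTheorem12 j L h L≥3 h-odd =
  let m = 2 ^ L * h + 1
      P = 2 ^ ⌈log₂ (m + j) ⌉
      (q , q≤2 , flip) = flip-offset h h-odd
      (match , match') = thue-morse-matches L h q L≥3 flip
      (k , isK , bound) = bounded-K j m ⌈log₂ (m + j) ⌉ (2 + 2 ^ L * q)
                            (m≤n+m 1 (2 ^ L * h)) (≤-2^⌈log₂⌉ (m + j)) (s≤s z≤n) match match'
  in k , isK , <-≤-trans bound (+-monoʳ-≤ (P * m) (*-monoʳ-≤ P (position-bound L q q≤2)))
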